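{- For every integer $k \geq 2$, $$ gr_{k}(K_{3} : W_{5}) \geq \begin{cases} 14\cdot 5^{(k - 2)/2} + 1 & \text{if $k$ is even,}\\ 28\cdot 5^{(k - 3)/2} + 1 & \text{if $k$ is odd.} \end{cases} $$
   Context: The wheel $W_5 = K_1 \vee C_4$ is the graph on $5$ vertices consisting of a $4$-cycle and a vertex adjacent to all four cycle vertices. For graphs $G$, $H$ and a positive integer $k$, the Gallai-Ramsey number $gr_k(G:H)$ is the minimum integer $m$ such that every coloring of the edges of $K_m$ using at most $k$ colors contains either a rainbow copy of $G$ (all edges receiving distinct colors) or a monochromatic copy of $H$. -}

module Defs where

open import Data.Nat using (ℕ)
open import Data.Fin using (Fin; zero; suc)
open import Data.Product using (Σ; _×_; ∃-syntax)
open import Data.Sum using (_⊎_)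
open import Function.Definitions using (Injective)
open import Relation.Binary.PropositionalEquality using (_≡_; _≢_)

-- An edge-colouring of the complete graph K_m using (at most) k colours:
-- a symmetric map on pairs of vertices (the value on the diagonal i = i is
-- irrelevant, since only pairs of distinct vertices are ever inspected).
record Colouring (m k : ℕ) : Set where
  field
    col  : Fin m → Fin m → Fin k
    symm : ∀ i j → col i j ≡ col j i
open Colouring public

RainbowK3 : ∀ {m k} → Colouring m k → Set
RainbowK3 {m} c = ∃[ a ] ∃[ b ] ∃[ d ]
  (a ≢ b × b ≢ d × a ≢ d ×
   col c a b ≢ col c b d × col c a b ≢ col c a d × col c b d ≢ col c a d)

-- Vertices of W_5: 0 is the hub, 1-2-3-4-1 is the 4-cycle.
w0 w1 w2 w3 w4 : Fin 5
w0 = zero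
w1 = suc zero
w2 = suc (suc zero)
w3 = suc (suc (suc zero))
w4 = suc (suc (suc (suc zero)))

-- A monochromatic copy of W_5 (not necessarily induced): an injective
-- placement of the 5 vertices into K_m such that all 8 edges of W_5
-- receive the same colour x.
MonoW5 : ∀ {m k} → Colouring m k → Set
MonoW5 {m} {k} c = Σ (Fin 5 → Fin m) λ f → Injective _≡_ _≡_ f × ∃[ x ]
  ( col c (f w0) (f w1) ≡ x × col c (f w0) (f w2) ≡ x
  × col c (f w0) (f w3) ≡ x × col c (f w0) (f w4) ≡ x
  × col c (f w1) (f w2) ≡ x × col c (f w2) (f w3) ≡ x
  × col c (f w3) (f w4) ≡ x × col c (f w4) (f w1) ≡ x )

-- m has the Gallai-Ramsey property for (K_3 : W_5) with k colours:
-- every k-colouring of K_m has a rainbow K_3 or a monochromatic W_5.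
-- gr_k(K_3 : W_5) is the least such m; so "gr_k ≥ N" means every such m is ≥ N.
GRProperty : ℕ → ℕ → Set
GRProperty k m = (c : Colouring m k) → RainbowK3 c ⊎ MonoW5 c

module Submission where

-- A 2-colouring of K₁₄ by two circulant colour classes has no monochromatic W₅.
-- Substituting a Gallai colouring into every vertex of a K₅ coloured with two fresh
-- colours as a pentagon and a pentagram multiplies the number of vertices by 5 and the
-- colouring stays good: blocks are homogeneous, so a triangle meeting exactly two blocks
-- is not rainbow; a W₅ in a fresh colour would contain a monochromatic triangle of the
-- pentagon, and a W₅ in an old colour lies inside the block of its hub.
-- Starting from K₁₄, or from two copies of it joined in a third colour, gives colourings
-- of K_{14·5ʲ} with 2j + 2 colours and of K_{28·5ʲ} with 2j + 3 colours.

open import Defs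
open import Data.Nat using (ℕ; _+_; _*_; _∸_; _^_; _≤_; _/_; _%_)
open import Data.Product using (_×_)
open import Relation.Binary.PropositionalEquality using (_≡_)

open import Data.Nat using (zero; suc; s≤s; _≰_; ∣_-_∣)
open import Data.Nat.Properties using (≰⇒>; +-comm; +-monoˡ-≤; ≤-trans; ≤-reflexive; *-identityʳ; *-commutativeSemigroup; ∣-∣-comm)
open import Data.Nat.DivMod using (m/n*n≤m)
open import Algebra.Properties.CommutativeSemigroup *-commutativeSemigroup using (x∙yz≈y∙xz)
open import Data.Fin using (Fin; zero; suc; toℕ; _≟_)
open import Data.Fin.Properties using (all?; inject≤-injective; +↔⊎; *↔×)
open import Data.Product using (_,_; proj₁; proj₂)
open import Data.Sum using (_⊎_; inj₁; inj₂; [_,_])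
open import Data.Empty using (⊥; ⊥-elim)
open import Function using (_∘_; _↣_; Injection; mk↣)
open import Function.Definitions using (Injective)
open import Function.Properties.Inverse using (↔⇒↣; ↔-sym)
open import Relation.Binary.Definitions using (DecidableEquality)
open import Relation.Binary.PropositionalEquality using (_≢_; refl; sym; trans; cong; cong₂; subst)
open import Relation.Nullary using (¬_; Dec; yes; no; ¬?)
open import Relation.Nullary.Decidable using (_×-dec_; _→-dec_; toWitness)

module _ {V C : Set} (col : V → V → C) where

  Symmetric : Set
  Symmetric = ∀ u v → col u v ≡ col v u

  Edge : C → V → V → Set
  Edge x u v = u ≢ v × col u v ≡ x

  Rainbow : V → V → V → Set
  Rainbow a b d =
    a ≢ b × b ≢ d × a ≢ d × col a b ≢ col b d × col a b ≢ col a d × col b d ≢ col a d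

  MonochromaticW5 : (Fin 5 → V) → C → Set
  MonochromaticW5 f x =
    ( col (f w0) (f w1) ≡ x × col (f w0) (f w2) ≡ x
    × col (f w0) (f w3) ≡ x × col (f w0) (f w4) ≡ x
    × col (f w1) (f w2) ≡ x × col (f w2) (f w3) ≡ x
    × col (f w3) (f w4) ≡ x × col (f w4) (f w1) ≡ x )

  RainbowTriangleFree : Set
  RainbowTriangleFree = ∀ a b d → ¬ Rainbow a b d

  MonochromaticTriangleFree : Set
  MonochromaticTriangleFree = ∀ x a b → Edge x a b → ∀ d → Edge x b d → ¬ Edge x a d

  W5Free : Set
  W5Free = ∀ f → Injective _≡_ _≡_ f → ∀ x → ¬ MonochromaticW5 f x

  -- No x-neighbourhood of a vertex h contains an x-coloured 4-cycle a b c d: the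
  -- shape of W5-freeness that a pruned exhaustive search can decide.
  NeighbourhoodsC4Free : Set
  NeighbourhoodsC4Free =
    ∀ x h a → Edge x h a →
    ∀ b → Edge x h b × Edge x a b →
    ∀ c → Edge x h c × Edge x b c × a ≢ c →
    ∀ d → Edge x h d × Edge x c d × Edge x d a → b ≡ d

  neighbourhoodsC4Free⇒W5Free : NeighbourhoodsC4Free → W5Free
  neighbourhoodsC4Free⇒W5Free c4free f f-inj x (e01 , e02 , e03 , e04 , e12 , e23 , e34 , e41) =
    apart w2 w4 (λ ())
      (c4free x (f w0) (f w1) (apart w0 w1 (λ ()) , e01)
        (f w2) ((apart w0 w2 (λ ()) , e02) , (apart w1 w2 (λ ()) , e12))
        (f w3) ((apart w0 w3 (λ ()) , e03) , (apart w2 w3 (λ ()) , e23) , apart w1 w3 (λ ()))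
        (f w4) ((apart w0 w4 (λ ()) , e04) , (apart w3 w4 (λ ()) , e34) , (apart w4 w1 (λ ()) , e41)))
    where
    apart : ∀ i j → i ≢ j → f i ≢ f j
    apart i j i≢j = i≢j ∘ f-inj

module _ {n k : ℕ} (col : Fin n → Fin n → Fin k) where

  edge? : ∀ x u v → Dec (Edge col x u v)
  edge? x u v = ¬? (u ≟ v) ×-dec col u v ≟ x

  monochromaticTriangleFree? : Dec (MonochromaticTriangleFree col)
  monochromaticTriangleFree? =
    all? λ x → all? λ a → all? λ b → edge? x a b →-dec
    all? λ d → edge? x b d →-dec ¬? (edge? x a d)

  neighbourhoodsC4Free? : Dec (NeighbourhoodsC4Free col)
  neighbourhoodsC4Free? =
    all? λ x → all? λ h → all? λ a → edge? x h a →-dec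
    all? λ b → (edge? x h b ×-dec edge? x a b) →-dec
    all? λ c → (edge? x h c ×-dec edge? x b c ×-dec ¬? (a ≟ c)) →-dec
    all? λ d → (edge? x h d ×-dec edge? x c d ×-dec edge? x d a) →-dec b ≟ d

record GoodColouring (V C : Set) : Set where
  field
    colour       : V → V → C
    symmetric    : Symmetric colour
    rainbow-free : RainbowTriangleFree colour
    w5-free      : W5Free colour

record ReducedColouring (U D : Set) : Set where
  field
    colour        : U → U → D
    symmetric     : Symmetric colour
    rainbow-free  : RainbowTriangleFree colour
    triangle-free : MonochromaticTriangleFree colour

no-three-distinct-Fin2 : {x y z : Fin 2} → x ≢ y → y ≢ z → x ≢ z → ⊥
no-three-distinct-Fin2 {zero}     {zero}              x≢y _   _   = x≢y refl
no-three-distinct-Fin2 {suc zero} {suc zero}          x≢y _   _   = x≢y refl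
no-three-distinct-Fin2 {zero}     {suc zero} {zero}     _ _   x≢z = x≢z refl
no-three-distinct-Fin2 {zero}     {suc zero} {suc zero} _ y≢z _   = y≢z refl
no-three-distinct-Fin2 {suc zero} {zero}     {zero}     _ y≢z _   = y≢z refl
no-three-distinct-Fin2 {suc zero} {zero}     {suc zero} _ _   x≢z = x≢z refl

two-colours-rainbowTriangleFree : {V : Set} (col : V → V → Fin 2) → RainbowTriangleFree col
two-colours-rainbowTriangleFree _ _ _ _ (_ , _ , _ , r₁ , r₂ , r₃) = no-three-distinct-Fin2 r₁ r₃ r₂

≤⇒↣ : {m n : ℕ} → m ≤ n → Fin m ↣ Fin n
≤⇒↣ m≤n = mk↣ λ {i} {j} → inject≤-injective m≤n m≤n i j

reindex : {V V′ C C′ : Set} → V′ ↣ V → C ↣ C′ → GoodColouring V C → GoodColouring V′ C′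
reindex {_} {V′} {C} {C′} vertices colours G = record
  { colour       = col′
  ; symmetric    = λ u v → cong g (symmetric (f u) (f v))
  ; rainbow-free = λ a b d (a≢b , b≢d , a≢d , r₁ , r₂ , r₃) →
      rainbow-free (f a) (f b) (f d)
        (a≢b ∘ f-inj , b≢d ∘ f-inj , a≢d ∘ f-inj , r₁ ∘ cong g , r₂ ∘ cong g , r₃ ∘ cong g)
  ; w5-free      = λ h h-inj x (e01 , e02 , e03 , e04 , e12 , e23 , e34 , e41) →
      w5-free (f ∘ h) (h-inj ∘ f-inj) _
        (refl , pull e02 e01 , pull e03 e01 , pull e04 e01 ,
         pull e12 e01 , pull e23 e01 , pull e34 e01 , pull e41 e01)
  }
  where
  open GoodColouring G
  open Injection vertices using () renaming (to to f; injective to f-inj)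
  open Injection colours using () renaming (to to g; injective to g-inj)

  col′ : V′ → V′ → C′
  col′ u v = g (colour (f u) (f v))

  pull : ∀ {x} {c c′ : C} → g c ≡ x → g c′ ≡ x → c ≡ c′
  pull e e′ = g-inj (trans e (sym e′))

¬GRProperty : {m k : ℕ} → GoodColouring (Fin m) (Fin k) → ¬ GRProperty k m
¬GRProperty G gr =
  [ (λ (a , b , d , rainbow) → rainbow-free a b d rainbow)
  , (λ (f , f-inj , x , mono) → w5-free f f-inj x mono)
  ] (gr (record { col = colour ; symm = symmetric }))
  where open GoodColouring G

gr-lower-bound : {n k k′ m : ℕ} → GoodColouring (Fin n) (Fin k) → k ≤ k′ →
                 GRProperty k′ m → n + 1 ≤ m
gr-lower-bound {n} {m = m} G k≤k′ gr = subst (_≤ m) (+-comm 1 n) (≰⇒> m≰n)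
  where
  m≰n : m ≰ n
  m≰n m≤n = ¬GRProperty (reindex (≤⇒↣ m≤n) (≤⇒↣ k≤k′) G) gr

module Substitution {U D V C : Set} (_≟ᵤ_ : DecidableEquality U)
                    (R : ReducedColouring U D) (G : GoodColouring V C) where
  open ReducedColouring R using () renaming
    (colour to σ; symmetric to σ-symmetric; rainbow-free to σ-rainbow-free; triangle-free to σ-triangle-free)
  open GoodColouring G using () renaming
    (colour to τ; symmetric to τ-symmetric; rainbow-free to τ-rainbow-free; w5-free to τ-w5-free)

  colour : U × V → U × V → D ⊎ C
  colour (u , v) (u′ , v′) with u ≟ᵤ u′
  ... | yes _ = inj₂ (τ v v′)
  ... | no  _ = inj₁ (σ u u′)

  inside : ∀ {u v v′} → colour (u , v) (u , v′) ≡ inj₂ (τ v v′)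
  inside {u} with u ≟ᵤ u
  ... | yes _  = refl
  ... | no u≢u = ⊥-elim (u≢u refl)

  between : ∀ {u u′ v v′} → u ≢ u′ → colour (u , v) (u′ , v′) ≡ inj₁ (σ u u′)
  between {u} {u′} u≢u′ with u ≟ᵤ u′
  ... | yes u≡u′ = ⊥-elim (u≢u′ u≡u′)
  ... | no  _    = refl

  inside⁻¹ : ∀ {u u′ v v′ c} → colour (u , v) (u′ , v′) ≡ inj₂ c → u ≡ u′ × τ v v′ ≡ c
  inside⁻¹ {u} {u′} e with u ≟ᵤ u′
  inside⁻¹ refl | yes u≡u′ = u≡u′ , refl

  between⁻¹ : ∀ {u u′ v v′ x} → colour (u , v) (u′ , v′) ≡ inj₁ x → Edge σ x u u′
  between⁻¹ {u} {u′} e with u ≟ᵤ u′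
  between⁻¹ refl | no u≢u′ = u≢u′ , refl

  homogeneous : ∀ {u u′ v v′ w w′} → u ≢ u′ → colour (u , v) (u′ , v′) ≡ colour (u , w) (u′ , w′)
  homogeneous u≢u′ = trans (between u≢u′) (sym (between u≢u′))

  symmetric : Symmetric colour
  symmetric (u , v) (u′ , v′) with u ≟ᵤ u′
  ... | yes refl = trans (cong inj₂ (τ-symmetric v v′)) (sym inside)
  ... | no  u≢u′ = trans (cong inj₁ (σ-symmetric u u′)) (sym (between (u≢u′ ∘ sym)))

  rainbow-free-by-blocks : ∀ {u₁ u₂ u₃ v₁ v₂ v₃} → Dec (u₁ ≡ u₂) → Dec (u₂ ≡ u₃) → Dec (u₁ ≡ u₃) →
                           ¬ Rainbow colour (u₁ , v₁) (u₂ , v₂) (u₃ , v₃)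
  rainbow-free-by-blocks {u₁} {v₁ = v₁} {v₂} {v₃} (yes refl) (yes refl) _ (≢₁₂ , ≢₂₃ , ≢₁₃ , r₁ , r₂ , r₃) =
    τ-rainbow-free v₁ v₂ v₃
      (≢₁₂ ∘ cong (u₁ ,_) , ≢₂₃ ∘ cong (u₁ ,_) , ≢₁₃ ∘ cong (u₁ ,_) ,
       inside-≢ r₁ , inside-≢ r₂ , inside-≢ r₃)
    where
    inside-≢ : ∀ {u a b c d} → colour (u , a) (u , b) ≢ colour (u , c) (u , d) → τ a b ≢ τ c d
    inside-≢ ne e = ne (trans inside (trans (cong inj₂ e) (sym inside)))
  rainbow-free-by-blocks (yes refl) (no u₂≢u₃) _ (_ , _ , _ , _ , _ , r₃) = r₃ (homogeneous u₂≢u₃)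
  rainbow-free-by-blocks (no u₁≢u₂) (yes refl) _ (_ , _ , _ , _ , r₂ , _) = r₂ (homogeneous u₁≢u₂)
  rainbow-free-by-blocks (no u₁≢u₂) (no _) (yes refl) (_ , _ , _ , r₁ , _ , _) =
    r₁ (trans (homogeneous u₁≢u₂) (symmetric _ _))
  rainbow-free-by-blocks {u₁} {u₂} {u₃} (no u₁≢u₂) (no u₂≢u₃) (no u₁≢u₃) (_ , _ , _ , r₁ , r₂ , r₃) =
    σ-rainbow-free u₁ u₂ u₃
      (u₁≢u₂ , u₂≢u₃ , u₁≢u₃ ,
       between-≢ u₁≢u₂ u₂≢u₃ r₁ , between-≢ u₁≢u₂ u₁≢u₃ r₂ , between-≢ u₂≢u₃ u₁≢u₃ r₃)
    where
    between-≢ : ∀ {a b c d v v′ w w′} → a ≢ b → c ≢ d →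
                colour (a , v) (b , v′) ≢ colour (c , w) (d , w′) → σ a b ≢ σ c d
    between-≢ a≢b c≢d ne e = ne (trans (between a≢b) (trans (cong inj₁ e) (sym (between c≢d))))

  rainbow-free : RainbowTriangleFree colour
  rainbow-free (u₁ , _) (u₂ , _) (u₃ , _) = rainbow-free-by-blocks (u₁ ≟ᵤ u₂) (u₂ ≟ᵤ u₃) (u₁ ≟ᵤ u₃)

  w5-free : W5Free colour
  w5-free _ _ (inj₁ x) (e01 , e02 , _ , _ , e12 , _ , _ , _) =
    σ-triangle-free x _ _ (between⁻¹ e01) _ (between⁻¹ e12) (between⁻¹ e02)
  w5-free f f-inj (inj₂ c) (e01 , e02 , e03 , e04 , e12 , e23 , e34 , e41) =
    τ-w5-free (proj₂ ∘ f) (λ {i} {j} → f-inj ∘ cong₂ _,_ (trans (sym (hub-block i)) (hub-block j))) c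
      (τ-coloured e01 , τ-coloured e02 , τ-coloured e03 , τ-coloured e04 ,
       τ-coloured e12 , τ-coloured e23 , τ-coloured e34 , τ-coloured e41)
    where
    τ-coloured : ∀ {u u′ v v′} → colour (u , v) (u′ , v′) ≡ inj₂ c → τ v v′ ≡ c
    τ-coloured = proj₂ ∘ inside⁻¹

    hub-block : ∀ i → proj₁ (f w0) ≡ proj₁ (f i)
    hub-block zero                         = refl
    hub-block (suc zero)                   = proj₁ (inside⁻¹ e01)
    hub-block (suc (suc zero))             = proj₁ (inside⁻¹ e02)
    hub-block (suc (suc (suc zero)))       = proj₁ (inside⁻¹ e03)
    hub-block (suc (suc (suc (suc zero)))) = proj₁ (inside⁻¹ e04)

  colouring : GoodColouring (U × V) (D ⊎ C)
  colouring = record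
    { colour = colour ; symmetric = symmetric ; rainbow-free = rainbow-free ; w5-free = w5-free }

substitute : {p d n k : ℕ} → ReducedColouring (Fin p) (Fin d) → GoodColouring (Fin n) (Fin k) →
             GoodColouring (Fin (p * n)) (Fin (d + k))
substitute R G = reindex (↔⇒↣ *↔×) (↔⇒↣ (↔-sym +↔⊎)) (Substitution.colouring _≟_ R G)

byDistance : {n : ℕ} {C : Set} → (ℕ → C) → Fin n → Fin n → C
byDistance c i j = c ∣ toℕ i - toℕ j ∣

byDistance-symmetric : {n : ℕ} {C : Set} (c : ℕ → C) → Symmetric (byDistance {n} c)
byDistance-symmetric c i j = cong c (∣-∣-comm (toℕ i) (toℕ j))

-- Colour 0 is the circulant graph on ℤ/14 with connection set {±1, ±3, ±4}.
distances14 : ℕ → Fin 2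
distances14 1  = zero
distances14 3  = zero
distances14 4  = zero
distances14 10 = zero
distances14 11 = zero
distances14 13 = zero
distances14 _  = suc zero

K14-colouring : GoodColouring (Fin 14) (Fin 2)
K14-colouring = record
  { colour       = byDistance distances14
  ; symmetric    = byDistance-symmetric distances14
  ; rainbow-free = two-colours-rainbowTriangleFree _
  ; w5-free      = neighbourhoodsC4Free⇒W5Free _
                     (toWitness {a? = neighbourhoodsC4Free? (byDistance distances14)} _)
  }

-- Colour 0 is the 5-cycle 0-1-2-3-4-0, colour 1 the complementary pentagram.
distances5 : ℕ → Fin 2
distances5 1 = zero
distances5 4 = zero
distances5 _ = suc zero

pentagon : ReducedColouring (Fin 5) (Fin 2)
pentagon = record
  { colour        = byDistance distances5
  ; symmetric     = byDistance-symmetric distances5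
  ; rainbow-free  = two-colours-rainbowTriangleFree _
  ; triangle-free = toWitness {a? = monochromaticTriangleFree? (byDistance distances5)} _
  }

single-edge : ReducedColouring (Fin 2) (Fin 1)
single-edge = record
  { colour        = λ _ _ → zero
  ; symmetric     = λ _ _ → refl
  ; rainbow-free  = λ _ _ _ (a≢b , b≢d , a≢d , _) → no-three-distinct-Fin2 a≢b b≢d a≢d
  ; triangle-free = λ _ _ _ (a≢b , _) _ (b≢d , _) (a≢d , _) → no-three-distinct-Fin2 a≢b b≢d a≢d
  }

recount : {n n′ : ℕ} {C : Set} → n ≡ n′ → GoodColouring (Fin n) C → GoodColouring (Fin n′) C
recount {C = C} = subst (λ N → GoodColouring (Fin N) C)

substitute-pentagons : {n k : ℕ} → GoodColouring (Fin n) (Fin k) →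
                       ∀ j → GoodColouring (Fin (n * 5 ^ j)) (Fin (j * 2 + k))
substitute-pentagons {n} G zero    = recount (sym (*-identityʳ n)) G
substitute-pentagons {n} G (suc j) =
  recount (x∙yz≈y∙xz 5 n (5 ^ j)) (substitute pentagon (substitute-pentagons G j))

n/2*2+c≤c+n : ∀ n c → n / 2 * 2 + c ≤ c + n
n/2*2+c≤c+n n c = ≤-trans (+-monoˡ-≤ c (m/n*n≤m n 2)) (≤-reflexive (+-comm n c))

even-lower-bound : ∀ n m → GRProperty (2 + n) m → 14 * 5 ^ (n / 2) + 1 ≤ m
even-lower-bound n m = gr-lower-bound (substitute-pentagons K14-colouring (n / 2)) (n/2*2+c≤c+n n 2)

odd-lower-bound : ∀ n m → GRProperty (3 + n) m → 28 * 5 ^ (n / 2) + 1 ≤ m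
odd-lower-bound n m =
  gr-lower-bound (substitute-pentagons (substitute single-edge K14-colouring) (n / 2)) (n/2*2+c≤c+n n 3)

-- The parity of k only matters in excluding k = 2 from the odd bound.
lemma4 : (k : ℕ) → 2 ≤ k → (m : ℕ) → GRProperty k m →
    (k % 2 ≡ 0 → 14 * 5 ^ ((k ∸ 2) / 2) + 1 ≤ m) ×
    (k % 2 ≡ 1 → 28 * 5 ^ ((k ∸ 3) / 2) + 1 ≤ m)
lemma4 (suc zero) (s≤s ())
lemma4 (suc (suc zero)) _ m gr = (λ _ → even-lower-bound 0 m gr) , λ ()
lemma4 (suc (suc (suc n))) _ m gr = (λ _ → even-lower-bound (suc n) m gr) , (λ _ → odd-lower-bound n m gr)
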